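{- Let $P$ be a poset and $\prec$ an auxiliary relation on $P$. The following are equivalent: (1) $\prec$ satisfies the interpolation property: for all $x,z\in P$, if $x\prec z$ then there is $y\in P$ with $x\prec y\prec z$. (2) $(A^{\downarrow\prec})^{\downarrow\prec}=A^{\downarrow\prec}$ for every upper set $A$ of $P$. (3) The map $A\mapsto A^{\downarrow\prec}$ is a kernel operator on the lattice $(\mathcal{U}(P),\subseteq)$ of upper sets of $P$. (4) $(B^{\uparrow\prec})^{\uparrow\prec}=B^{\uparrow\prec}$ for every lower set $B$ of $P$. (5) The map $B\mapsto B^{\uparrow\prec}$ is a closure operator on the lattice $(\mathcal{L}(P),\subseteq)$ of lower sets of $P$.
   Context: For a poset $(P,\le)$ and $X\subseteq P$, $\mathord{\downarrow}X=\{x\mid \exists y\in X,\ x\le y\}$, $\mathord{\uparrow}X$ dually; lower/upper sets are those with $X=\mathord{\downarrow}X$ / $X=\mathord{\uparrow}X$; $\mathcal{U}(P)$ and $\mathcal{L}(P)$ are the sets of upper and lower sets. An auxiliary relation on $P$ is a binary relation $\prec$ such that: $x\prec y$ implies $x\le y$; $u\le x\prec y\le z$ implies $u\prec z$; if $P$ has a least element $\bot$ then $\bot\prec x$ for all $x$. Write $s_\prec(x)=\{y\mid y\prec x\}$. For $A\subseteq P$: $A^{\downarrow\prec}=\{x\in A\mid s_\prec(x)\cap A\neq\emptyset\}$ and $A^{\uparrow\prec}=\{x\in P\mid s_\prec(x)\subseteq\mathord{\downarrow}A\}$. A closure (kernel) operator on a poset $L$ is a monotone idempotent self-map $f$ with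 $x\le f(x)$ (resp. $f(x)\le x$) for all $x$. -}

module Defs where

open import Level using (Level; _⊔_)
open import Data.Product using (Σ; ∃; _×_; _,_)
open import Relation.Binary.Core using (Rel)
open import Relation.Binary.Bundles using (Poset)
open import Relation.Unary using (Pred; _⊆_)

_≐_ : {a ℓ : Level} {A : Set a} → Pred A ℓ → Pred A ℓ → Set (a ⊔ ℓ)
X ≐ Y = (X ⊆ Y) × (Y ⊆ X)

module _ {c ℓ₁ ℓ₂ : Level} (P : Poset c ℓ₁ ℓ₂) where
  open Poset P

  -- Level used for subsets of P (large enough to contain ↓X, A^{↓≺}, etc.)
  SetLevel : Level → Level
  SetLevel ℓ₃ = c ⊔ ℓ₂ ⊔ ℓ₃

  record IsAuxiliary {ℓ₃ : Level} (_≺_ : Rel Carrier ℓ₃) : Set (c ⊔ ℓ₂ ⊔ ℓ₃) where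
    field
      ≺⇒≤    : ∀ {x y} → x ≺ y → x ≤ y
      ≤≺≤⇒≺  : ∀ {u x y z} → u ≤ x → x ≺ y → y ≤ z → u ≺ z
      bottom : ∀ b → (∀ x → b ≤ x) → ∀ x → b ≺ x

  ↓_ : {ℓ : Level} → Pred Carrier ℓ → Pred Carrier (c ⊔ ℓ₂ ⊔ ℓ)
  (↓ X) x = ∃ λ y → X y × x ≤ y

  IsUpperSet : {ℓ : Level} → Pred Carrier ℓ → Set (c ⊔ ℓ₂ ⊔ ℓ)
  IsUpperSet A = ∀ {x y} → x ≤ y → A x → A y

  IsLowerSet : {ℓ : Level} → Pred Carrier ℓ → Set (c ⊔ ℓ₂ ⊔ ℓ)
  IsLowerSet B = ∀ {x y} → y ≤ x → B x → B y


  module _ {ℓ₃ : Level} (_≺_ : Rel Carrier ℓ₃) where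

    s≺ : Carrier → Pred Carrier ℓ₃
    s≺ x y = y ≺ x

    down≺ : Pred Carrier (SetLevel ℓ₃) → Pred Carrier (SetLevel ℓ₃)
    down≺ A x = A x × ∃ λ y → y ≺ x × A y

    up≺ : Pred Carrier (SetLevel ℓ₃) → Pred Carrier (SetLevel ℓ₃)
    up≺ A x = ∀ {y} → y ≺ x → (↓ A) y

    Interpolative : Set (c ⊔ ℓ₃)
    Interpolative = ∀ {x z} → x ≺ z → ∃ λ y → x ≺ y × y ≺ z

    IsKernelOnUpperSets : (Pred Carrier (SetLevel ℓ₃) → Pred Carrier (SetLevel ℓ₃))
                          → Set (Level.suc (c ⊔ ℓ₂ ⊔ ℓ₃))
    IsKernelOnUpperSets f =
      (∀ A → IsUpperSet A → IsUpperSet (f A)) ×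
      (∀ A B → IsUpperSet A → IsUpperSet B → A ⊆ B → f A ⊆ f B) ×
      (∀ A → IsUpperSet A → f (f A) ≐ f A) ×
      (∀ A → IsUpperSet A → f A ⊆ A)

    IsClosureOnLowerSets : (Pred Carrier (SetLevel ℓ₃) → Pred Carrier (SetLevel ℓ₃))
                           → Set (Level.suc (c ⊔ ℓ₂ ⊔ ℓ₃))
    IsClosureOnLowerSets f =
      (∀ B → IsLowerSet B → IsLowerSet (f B)) ×
      (∀ A B → IsLowerSet A → IsLowerSet B → A ⊆ B → f A ⊆ f B) ×
      (∀ B → IsLowerSet B → f (f B) ≐ f B) ×
      (∀ B → IsLowerSet B → B ⊆ f B)

module Submission where

-- An element x of A^{↓≺} has a witness y ≺ x in A; interpolating y ≺ w ≺ x turns w into a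
-- witness lying in A^{↓≺} itself, so A^{↓≺} is idempotent; dually for A^{↑≺}. Conversely,
-- idempotence applied to the principal upper set ↑x (resp. to the lower set of elements two
-- ≺-steps below z) hands back an interpolant for x ≺ z. The remaining kernel/closure laws
-- (monotonicity, (de)flation, preservation of upper/lower sets) hold for every auxiliary relation.

open import Defs
open import Level using (Level; Lift; lift)
open import Data.Product using (∃; _×_; _,_; proj₁; proj₂)
open import Relation.Binary.Core using (Rel)
open import Relation.Binary.Bundles using (Poset)
open import Relation.Unary using (Pred; _⊆_)
open import Function.Base using (_∘_)
open import Function.Bundles using (_⇔_; mk⇔)

module AuxiliaryRelation {c ℓ₁ ℓ₂ ℓ₃ : Level} (P : Poset c ℓ₁ ℓ₂)
                         {_≺_ : Rel (Poset.Carrier P) ℓ₃} (aux : IsAuxiliary P _≺_) where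
  open Poset P
  open IsAuxiliary aux

  private
    Subset : Set (c Level.⊔ Level.suc (SetLevel P ℓ₃))
    Subset = Pred Carrier (SetLevel P ℓ₃)

  ≺-≤-trans : ∀ {x y z} → x ≺ y → y ≤ z → x ≺ z
  ≺-≤-trans = ≤≺≤⇒≺ refl

  ≤-≺-trans : ∀ {u x y} → u ≤ x → x ≺ y → u ≺ y
  ≤-≺-trans u≤x x≺y = ≤≺≤⇒≺ u≤x x≺y refl

  private
    D U : Subset → Subset
    D = down≺ P _≺_
    U = up≺ P _≺_

  ↑[_] : Carrier → Subset
  ↑[ x ] w = Lift (c Level.⊔ ℓ₃) (x ≤ w)

  ↑[]-isUpperSet : ∀ x → IsUpperSet P ↑[ x ]
  ↑[]-isUpperSet x w≤v (lift x≤w) = lift (trans x≤w w≤v)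

  ≺²[_] : Carrier → Subset
  ≺²[ z ] w = Lift (c Level.⊔ ℓ₂) (∃ λ y → w ≺ y × y ≺ z)

  ≺²[]-isLowerSet : ∀ z → IsLowerSet P ≺²[ z ]
  ≺²[]-isLowerSet z v≤w (lift (y , w≺y , y≺z)) = lift (y , ≤-≺-trans v≤w w≺y , y≺z)

  ≺²[]-centre-∈-up≺-up≺ : ∀ z → U (U ≺²[ z ]) z
  ≺²[]-centre-∈-up≺-up≺ z {v} v≺z = v , (λ {t} t≺v → t , lift (v , t≺v , v≺z) , refl) , refl

  down≺-deflationary : ∀ A → D A ⊆ A
  down≺-deflationary A = proj₁

  down≺-monotone : ∀ {A B} → A ⊆ B → D A ⊆ D B
  down≺-monotone A⊆B (xA , y , y≺x , yA) = A⊆B xA , y , y≺x , A⊆B yA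

  down≺-isUpperSet : ∀ A → IsUpperSet P A → IsUpperSet P (D A)
  down≺-isUpperSet A A-up x≤z (xA , y , y≺x , yA) = A-up x≤z xA , y , ≺-≤-trans y≺x x≤z , yA

  up≺-inflationary : ∀ B → B ⊆ U B
  up≺-inflationary B {x} xB y≺x = x , xB , ≺⇒≤ y≺x

  up≺-monotone : ∀ {A B} → A ⊆ B → U A ⊆ U B
  up≺-monotone A⊆B xU y≺x with xU y≺x
  ... | w , wA , y≤w = w , A⊆B wA , y≤w

  up≺-isLowerSet : ∀ B → IsLowerSet P (U B)
  up≺-isLowerSet B z≤x xU y≺z = xU (≺-≤-trans y≺z z≤x)

  interpolative⇒down≺-idempotent : Interpolative P _≺_ →
                                   ∀ A → IsUpperSet P A → D (D A) ≐ D A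
  interpolative⇒down≺-idempotent interp A A-up =
    down≺-deflationary (D A) , D-A⊆D-D-A
    where
    D-A⊆D-D-A : D A ⊆ D (D A)
    D-A⊆D-D-A xD@(xA , y , y≺x , yA) with interp y≺x
    ... | w , y≺w , w≺x = xD , w , w≺x , (A-up (≺⇒≤ y≺w) yA , y , y≺w , yA)

  down≺-idempotent⇒interpolative : (∀ A → IsUpperSet P A → D (D A) ≐ D A) →
                                   Interpolative P _≺_
  down≺-idempotent⇒interpolative idem {x} x≺z
    with proj₂ (idem ↑[ x ] (↑[]-isUpperSet x)) (lift (≺⇒≤ x≺z) , x , x≺z , lift refl)
  ... | _ , y , y≺z , (_ , u , u≺y , lift x≤u) = y , ≤-≺-trans x≤u u≺y , y≺z

  interpolative⇒up≺-idempotent : Interpolative P _≺_ →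
                                 ∀ B → IsLowerSet P B → U (U B) ≐ U B
  interpolative⇒up≺-idempotent interp B _ =
    U-U-B⊆U-B , up≺-inflationary (U B)
    where
    U-U-B⊆U-B : U (U B) ⊆ U B
    U-U-B⊆U-B xUU y≺x with interp y≺x
    ... | w , y≺w , w≺x with xUU w≺x
    ...   | u , uU , w≤u = uU (≺-≤-trans y≺w w≤u)

  up≺-idempotent⇒interpolative : (∀ B → IsLowerSet P B → U (U B) ≐ U B) →
                                 Interpolative P _≺_
  up≺-idempotent⇒interpolative idem {x} {z} x≺z
    with proj₁ (idem ≺²[ z ] (≺²[]-isLowerSet z)) (≺²[]-centre-∈-up≺-up≺ z) x≺z
  ... | w , lift (y , w≺y , y≺z) , x≤w = y , ≤-≺-trans x≤w w≺y , y≺z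

  interpolative⇒down≺-isKernel : Interpolative P _≺_ → IsKernelOnUpperSets P _≺_ D
  interpolative⇒down≺-isKernel interp =
      down≺-isUpperSet
    , (λ _ _ _ _ → down≺-monotone)
    , interpolative⇒down≺-idempotent interp
    , (λ A _ → down≺-deflationary A)

  interpolative⇒up≺-isClosure : Interpolative P _≺_ → IsClosureOnLowerSets P _≺_ U
  interpolative⇒up≺-isClosure interp =
      (λ B _ → up≺-isLowerSet B)
    , (λ _ _ _ _ → up≺-monotone)
    , interpolative⇒up≺-idempotent interp
    , (λ B _ → up≺-inflationary B)

theorem3p9 : {c ℓ₁ ℓ₂ ℓ₃ : Level} (P : Poset c ℓ₁ ℓ₂) (_≺_ : Rel (Poset.Carrier P) ℓ₃) →
    IsAuxiliary P _≺_ →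
    (Interpolative P _≺_ ⇔ (∀ A → IsUpperSet P A → down≺ P _≺_ (down≺ P _≺_ A) ≐ down≺ P _≺_ A)) ×
    (Interpolative P _≺_ ⇔ IsKernelOnUpperSets P _≺_ (down≺ P _≺_)) ×
    (Interpolative P _≺_ ⇔ (∀ B → IsLowerSet P B → up≺ P _≺_ (up≺ P _≺_ B) ≐ up≺ P _≺_ B)) ×
    (Interpolative P _≺_ ⇔ IsClosureOnLowerSets P _≺_ (up≺ P _≺_))
theorem3p9 P _≺_ aux =
    mk⇔ interpolative⇒down≺-idempotent down≺-idempotent⇒interpolative
  , mk⇔ interpolative⇒down≺-isKernel (down≺-idempotent⇒interpolative ∘ idempotence)
  , mk⇔ interpolative⇒up≺-idempotent up≺-idempotent⇒interpolative
  , mk⇔ interpolative⇒up≺-isClosure (up≺-idempotent⇒interpolative ∘ idempotence)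
  where
  open AuxiliaryRelation P aux
  idempotence : ∀ {f m i e} {F : Set f} {M : Set m} {I : Set i} {E : Set e} → F × M × I × E → I
  idempotence (_ , _ , idem , _) = idem
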